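{- Let $G_1$ be an $r_1$-regular finite simple graph and $G_2$ an $r_2$-regular finite simple graph with $r_1>r_2$, and let $p_i=|V(G_i)|$, $q_i=|E(G_i)|$ for $i=1,2$. Then $\nu^*(G_1\sqcup G_2)=\nu^*(G_1)+\nu^*(G_2)+2q_1(p_2+q_2)$, where $\sqcup$ denotes disjoint union.
   Context: For a finite simple graph $G=(V,E)$ with $p=|V|$, $q=|E|$, $\ell=p+q$, a construction sequence (c-sequence) for $G$ is a bijection $x:\{1,\dots,\ell\}\to V\sqcup E$ such that for every edge $e=uw$, $x^{ -1}(e)>\max\{x^{ -1}(u),x^{ -1}(w)\}$. The cost of an edge $e=uw$ in $x$ is $\nu(e,x)=(x^{ -1}(e)-x^{ -1}(u))+(x^{ -1}(e)-x^{ -1}(w))$, and the cost of $x$ is $\nu(x)=\sum_{e\in E}\nu(e,x)$. The max cost of $G$ is $\nu^*(G)=\max\nu(x)$ over all c-sequences $x$ for $G$. -}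

module Defs where

open import Data.Nat using (ℕ; _+_; _*_; _∸_; _<_; _≤_)
open import Data.Fin using (Fin; toℕ; _↑ˡ_; _↑ʳ_; splitAt)
open import Data.Fin.Properties using (_≟_)
open import Data.List using (List; length; filter; map; allFin)
open import Data.Nat.ListAction using (sum)
open import Data.Product using (_×_; _,_; proj₁; proj₂; Σ; ∃)
open import Data.Sum using (_⊎_; inj₁; inj₂)
open import Relation.Binary.PropositionalEquality using (_≡_; _≢_)
open import Relation.Nullary using (¬_)
open import Relation.Nullary.Decidable using (_⊎-dec_)
open import Function.Bundles using (_↔_; Inverse)

record Graph : Set where
  constructor mkGraph
  field
    p    : ℕ
    q    : ℕ
    ends : Fin q → Fin p × Fin p

open Graph public

record IsSimple (G : Graph) : Set where
  field
    loopless : ∀ e → proj₁ (ends G e) ≢ proj₂ (ends G e)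
    noMulti  : ∀ e f →
      (proj₁ (ends G e) ≡ proj₁ (ends G f) × proj₂ (ends G e) ≡ proj₂ (ends G f)) ⊎
      (proj₁ (ends G e) ≡ proj₂ (ends G f) × proj₂ (ends G e) ≡ proj₁ (ends G f)) →
      e ≡ f

degree : (G : Graph) → Fin (p G) → ℕ
degree G v = length (filter (λ e → (proj₁ (ends G e) ≟ v) ⊎-dec (proj₂ (ends G e) ≟ v)) (allFin (q G)))

Regular : ℕ → Graph → Set
Regular r G = ∀ v → degree G v ≡ r

Elem : Graph → Set
Elem G = Fin (p G) ⊎ Fin (q G)

-- A bijection x : {1..ℓ} → V ⊔ E (positions are 0-based here; costs are
-- differences of positions, so the shift is irrelevant).
Seq : Graph → Set
Seq G = Fin (p G + q G) ↔ Elem G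

pos : (G : Graph) → Seq G → Elem G → ℕ
pos G x a = toℕ (Inverse.from x a)

IsCSeq : (G : Graph) → Seq G → Set
IsCSeq G x = ∀ e →
  (pos G x (inj₁ (proj₁ (ends G e))) < pos G x (inj₂ e)) ×
  (pos G x (inj₁ (proj₂ (ends G e))) < pos G x (inj₂ e))

edgeCost : (G : Graph) → Seq G → Fin (q G) → ℕ
edgeCost G x e =
  (pos G x (inj₂ e) ∸ pos G x (inj₁ (proj₁ (ends G e)))) +
  (pos G x (inj₂ e) ∸ pos G x (inj₁ (proj₂ (ends G e))))

cost : (G : Graph) → Seq G → ℕ
cost G x = sum (map (edgeCost G x) (allFin (q G)))

IsMaxCost : Graph → ℕ → Set
IsMaxCost G m =
  (Σ (Seq G) λ x → IsCSeq G x × cost G x ≡ m) ×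
  (∀ (x : Seq G) → IsCSeq G x → cost G x ≤ m)

inl : ∀ {a} b → Fin a × Fin a → Fin (a + b) × Fin (a + b)
inl b (u , w) = (u ↑ˡ b , w ↑ˡ b)

inr : ∀ a {b} → Fin b × Fin b → Fin (a + b) × Fin (a + b)
inr a (u , w) = (a ↑ʳ u , a ↑ʳ w)

unionEnds : (G H : Graph) → Fin (q G + q H) → Fin (p G + p H) × Fin (p G + p H)
unionEnds G H e with splitAt (q G) e
... | inj₁ e₁ = inl (p H) (ends G e₁)
... | inj₂ e₂ = inr (p G) (ends H e₂)

_⊔_ : Graph → Graph → Graph
G ⊔ H = mkGraph (p G + p H) (q G + q H) (unionEnds G H)

module Submission where

-- In a construction sequence an edge e = uw costs 2 pos(e) − pos(u) − pos(w), so the cost is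
-- 2 Σₑ pos(e) − Σᵥ deg(v) pos(v); as all positions together sum to the triangle number
-- T(ℓ) = 0 + 1 + ⋯ + (ℓ − 1), this is 2 T(ℓ) − Σᵥ (2 + deg v) pos(v).  Maximising the cost
-- thus means minimising a weighted sum of vertex positions.  For an r-regular graph the
-- weights are constant and the vertices-first sequence is optimal, with cost 2 T(p+q) − (2+r) T(p).
-- In G₁ ⊔ G₂ with r₁ > r₂ the heavier vertices of G₁ should come first, then those of G₂,
-- then all edges; comparing the resulting closed forms (using r₂ p₂ = 2 q₂) gives the formula.

open import Defs
open import Data.Nat using (ℕ; zero; suc; _+_; _*_; _∸_; _<_; _≤_; _>_; _≤?_; z≤n; s≤s)
open import Data.Nat.Properties hiding (_≟_)
open import Data.Nat.Tactic.RingSolver using (solve-∀; solve)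
open import Algebra.Properties.Semiring.Sum +-*-semiring
  using (sum; sum-cong-≗; ∑-distrib-+; ∑-comm; sum-permute; sum-remove;
         *-distribˡ-sum; *-distribʳ-sum)
open import Data.Fin using (Fin; zero; suc; toℕ; _↑ˡ_; _↑ʳ_; splitAt; fromℕ<; punchIn)
open import Data.Fin.Properties
  using (_≟_; toℕ-injective; toℕ-↑ˡ; toℕ-↑ʳ; ↑ˡ-injective; splitAt-↑ˡ; splitAt-↑ʳ;
         +↔⊎; toℕ<n; toℕ-fromℕ<; punchInᵢ≢i; punchIn-injective; injective⇒≤; any?)
open import Data.Vec.Functional using (removeAt)
open import Data.List using (length; filter; map; tabulate; _∷_; [])
import Data.Nat.ListAction as List
open import Data.Product using (_×_; _,_; proj₁; proj₂)
open import Data.Sum using (inj₁; inj₂)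
open import Data.Sum.Properties using (inj₁-injective)
open import Data.Bool using (true; false; if_then_else_)
open import Function using (_∘_)
open import Function.Bundles using (Inverse)
open import Function.Definitions using (Injective)
open import Function.Properties.Inverse using (↔-sym; ↔-trans)
open import Relation.Binary.PropositionalEquality
open import Relation.Nullary using (¬_; Dec; yes; no; does; contradiction)
open import Relation.Nullary.Decidable using (_⊎-dec_)
open import Relation.Unary using (Pred; Decidable)

triangle : ℕ → ℕ
triangle zero    = 0
triangle (suc n) = n + triangle n

triangle-+ : ∀ m n → triangle (m + n) ≡ triangle m + m * n + triangle n
triangle-+ zero    n = refl
triangle-+ (suc m) n = begin
  m + n + triangle (m + n)                   ≡⟨ cong (m + n +_) (triangle-+ m n) ⟩
  m + n + (triangle m + m * n + triangle n)  ≡⟨ shuffle m n (triangle m) (m * n) (triangle n) ⟩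
  m + triangle m + (n + m * n) + triangle n  ∎
  where
  open ≡-Reasoning
  shuffle : ∀ a b c d e → a + b + (c + d + e) ≡ a + c + (b + d) + e
  shuffle = solve-∀

sum-const : ∀ n c → sum {n} (λ _ → c) ≡ n * c
sum-const zero    c = refl
sum-const (suc n) c = cong (c +_) (sum-const n c)

sum-split : ∀ m {n} (f : Fin (m + n) → ℕ) →
  sum f ≡ sum (λ i → f (i ↑ˡ n)) + sum (λ j → f (m ↑ʳ j))
sum-split zero    f = refl
sum-split (suc m) f =
  trans (cong (f zero +_) (sum-split m (f ∘ suc))) (sym (+-assoc (f zero) _ _))

sum-toℕ : ∀ n → sum {n} toℕ ≡ triangle n
sum-toℕ zero    = refl
sum-toℕ (suc n) = begin
  sum {n} (λ i → 1 + toℕ i)       ≡⟨ ∑-distrib-+ {n} (λ _ → 1) toℕ ⟩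
  sum {n} (λ _ → 1) + sum {n} toℕ ≡⟨ cong₂ _+_ (trans (sum-const n 1) (*-identityʳ n)) (sum-toℕ n) ⟩
  n + triangle n                  ∎
  where open ≡-Reasoning

sum-map-tabulate : ∀ {A : Set} {n} (g : Fin n → A) (f : A → ℕ) →
  List.sum (map f (tabulate g)) ≡ sum (f ∘ g)
sum-map-tabulate {n = zero}  g f = refl
sum-map-tabulate {n = suc n} g f = cong (f (g zero) +_) (sum-map-tabulate (g ∘ suc) f)

indicator : ∀ {A : Set} → Dec A → ℕ
indicator a? = if does a? then 1 else 0

length-filter-tabulate : ∀ {A : Set} {P : Pred A _} (P? : Decidable P) {n} (g : Fin n → A) →
  length (filter P? (tabulate g)) ≡ sum (λ i → indicator (P? (g i)))
length-filter-tabulate P? {zero}  g = refl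
length-filter-tabulate P? {suc n} g with does (P? (g zero))
... | true  = cong suc (length-filter-tabulate P? (g ∘ suc))
... | false = length-filter-tabulate P? (g ∘ suc)

indicator-⊎ : ∀ {A B : Set} (a? : Dec A) (b? : Dec B) → ¬ (A × B) →
  indicator (a? ⊎-dec b?) ≡ indicator a? + indicator b?
indicator-⊎ (yes a) (yes b) ¬a×b = contradiction (a , b) ¬a×b
indicator-⊎ (yes a) (no ¬b) ¬a×b = refl
indicator-⊎ (no ¬a) (yes b) ¬a×b = refl
indicator-⊎ (no ¬a) (no ¬b) ¬a×b = refl

sum-indicator-≟ : ∀ {n} (a : Fin n) (f : Fin n → ℕ) →
  sum (λ v → indicator (a ≟ v) * f v) ≡ f a
sum-indicator-≟ {suc n} a f = begin
  sum δf                                  ≡⟨ sum-remove {i = a} δf ⟩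
  δf a + sum (removeAt δf a)              ≡⟨ cong₂ _+_ (cong (_* f a) (at-a (a ≟ a)))
                                                       (sum-cong-≗ {n} off-a) ⟩
  1 * f a + sum {n} (λ _ → 0)             ≡⟨ cong (1 * f a +_) (trans (sum-const n 0) (*-zeroʳ n)) ⟩
  1 * f a + 0                             ≡⟨ +-identityʳ _ ⟩
  1 * f a                                 ≡⟨ *-identityˡ _ ⟩
  f a                                     ∎
  where
  open ≡-Reasoning
  δf = λ v → indicator (a ≟ v) * f v
  at-a : (a≟a : Dec (a ≡ a)) → indicator a≟a ≡ 1
  at-a (yes _)  = refl
  at-a (no a≢a) = contradiction refl a≢a
  off-a : ∀ j → removeAt δf a j ≡ 0
  off-a j with a ≟ punchIn a j
  ... | yes a≡j = contradiction (sym a≡j) (punchInᵢ≢i a j)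
  ... | no _    = refl

Loopless : Graph → Set
Loopless G = ∀ e → proj₁ (ends G e) ≢ proj₂ (ends G e)

endpointSum : (G : Graph) → (Fin (p G) → ℕ) → ℕ
endpointSum G f = sum (λ e → f (proj₁ (ends G e)) + f (proj₂ (ends G e)))

module _ (G : Graph) (loopless : Loopless G) where

  private
    hits₁ hits₂ incident : Fin (q G) → Fin (p G) → ℕ
    hits₁ e v = indicator (proj₁ (ends G e) ≟ v)
    hits₂ e v = indicator (proj₂ (ends G e) ≟ v)
    incident e v = hits₁ e v + hits₂ e v

  degree-incident : ∀ v → degree G v ≡ sum (λ e → incident e v)
  degree-incident v = trans (length-filter-tabulate _ {q G} (λ e → e))
    (sum-cong-≗ {q G} (λ e → indicator-⊎ (proj₁ (ends G e) ≟ v) (proj₂ (ends G e) ≟ v)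
                                          (λ (u≡v , w≡v) → loopless e (trans u≡v (sym w≡v)))))

  sum-incident : (f : Fin (p G) → ℕ) (e : Fin (q G)) →
    sum (λ v → incident e v * f v) ≡ f (proj₁ (ends G e)) + f (proj₂ (ends G e))
  sum-incident f e = begin
    sum (λ v → incident e v * f v)
      ≡⟨ sum-cong-≗ {p G} (λ v → *-distribʳ-+ (f v) (hits₁ e v) (hits₂ e v)) ⟩
    sum (λ v → hits₁ e v * f v + hits₂ e v * f v)
      ≡⟨ ∑-distrib-+ {p G} (λ v → hits₁ e v * f v) (λ v → hits₂ e v * f v) ⟩
    sum (λ v → hits₁ e v * f v) + sum (λ v → hits₂ e v * f v)
      ≡⟨ cong₂ _+_ (sum-indicator-≟ (proj₁ (ends G e)) f) (sum-indicator-≟ (proj₂ (ends G e)) f) ⟩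
    f (proj₁ (ends G e)) + f (proj₂ (ends G e))
      ∎
    where open ≡-Reasoning

  handshake : (f : Fin (p G) → ℕ) → endpointSum G f ≡ sum (λ v → degree G v * f v)
  handshake f = begin
    endpointSum G f
      ≡⟨ sum-cong-≗ {q G} (sym ∘ sum-incident f) ⟩
    sum (λ e → sum (λ v → incident e v * f v))
      ≡⟨ ∑-comm {p G} {q G} _ ⟨
    sum (λ v → sum (λ e → incident e v * f v))
      ≡⟨ sum-cong-≗ {p G} (λ v → *-distribʳ-sum (f v) (λ e → incident e v)) ⟨
    sum (λ v → sum (λ e → incident e v) * f v)
      ≡⟨ sum-cong-≗ {p G} (λ v → cong (_* f v) (degree-incident v)) ⟨
    sum (λ v → degree G v * f v)
      ∎
    where open ≡-Reasoning

  module _ {r : ℕ} (regular : Regular r G) where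

    endpointSum-regular : (f : Fin (p G) → ℕ) → endpointSum G f ≡ r * sum f
    endpointSum-regular f = trans (handshake f)
      (trans (sum-cong-≗ {p G} (λ v → cong (_* f v) (regular v))) (sym (*-distribˡ-sum r f)))

    regular-handshake : r * p G ≡ 2 * q G
    regular-handshake = begin
      r * p G                 ≡⟨ cong (r *_) (trans (sym (*-identityʳ (p G))) (sym (sum-const (p G) 1))) ⟩
      r * sum {p G} (λ _ → 1) ≡⟨ endpointSum-regular (λ _ → 1) ⟨
      sum {q G} (λ _ → 2)     ≡⟨ trans (sum-const (q G) 2) (*-comm (q G) 2) ⟩
      2 * q G                 ∎
      where open ≡-Reasoning

vertexPosSum edgePosSum : (G : Graph) → Seq G → ℕ
vertexPosSum G x = sum (λ v → pos G x (inj₁ v))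
edgePosSum   G x = sum (λ e → pos G x (inj₂ e))

pos-injective : (G : Graph) (x : Seq G) → Injective _≡_ _≡_ (pos G x)
pos-injective G x {a} {b} pos≡ = begin
  a                           ≡⟨ strictlyInverseˡ a ⟨
  to (from a)                 ≡⟨ cong to (toℕ-injective pos≡) ⟩
  to (from b)                 ≡⟨ strictlyInverseˡ b ⟩
  b                           ∎
  where
  open ≡-Reasoning
  open Inverse x

vertexPosSum+edgePosSum : (G : Graph) (x : Seq G) →
  vertexPosSum G x + edgePosSum G x ≡ triangle (p G + q G)
vertexPosSum+edgePosSum G x = begin
  vertexPosSum G x + edgePosSum G x
    ≡⟨ cong₂ _+_ (sum-cong-≗ {p G} (λ v → cong pos′ (sym (splitAt-↑ˡ (p G) v (q G)))))
                 (sum-cong-≗ {q G} (λ e → cong pos′ (sym (splitAt-↑ʳ (p G) (q G) e)))) ⟩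
  sum (λ v → pos′ (splitAt (p G) (v ↑ˡ q G))) + sum (λ e → pos′ (splitAt (p G) (p G ↑ʳ e)))
    ≡⟨ sum-split (p G) (pos′ ∘ splitAt (p G)) ⟨
  sum (pos′ ∘ splitAt (p G))
    ≡⟨ sum-permute toℕ (↔-trans +↔⊎ (↔-sym x)) ⟨
  sum {p G + q G} toℕ
    ≡⟨ sum-toℕ (p G + q G) ⟩
  triangle (p G + q G)
    ∎
  where
  open ≡-Reasoning
  pos′ = pos G x

cost+endpointSum : (G : Graph) (x : Seq G) → IsCSeq G x →
  cost G x + endpointSum G (pos G x ∘ inj₁) ≡ 2 * edgePosSum G x
cost+endpointSum G x cseq = begin
  cost G x + sum endpointPos
    ≡⟨ cong (_+ sum endpointPos) (sum-map-tabulate {n = q G} (λ e → e) (edgeCost G x)) ⟩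
  sum (edgeCost G x) + sum endpointPos
    ≡⟨ ∑-distrib-+ (edgeCost G x) endpointPos ⟨
  sum (λ e → edgeCost G x e + endpointPos e)
    ≡⟨ sum-cong-≗ {q G} (λ e → ∸+∸+≡2* (<⇒≤ (proj₁ (cseq e))) (<⇒≤ (proj₂ (cseq e)))) ⟩
  sum (λ e → 2 * pos G x (inj₂ e))
    ≡⟨ *-distribˡ-sum 2 (λ e → pos G x (inj₂ e)) ⟨
  2 * edgePosSum G x
    ∎
  where
  open ≡-Reasoning
  endpointPos : Fin (q G) → ℕ
  endpointPos e = pos G x (inj₁ (proj₁ (ends G e))) + pos G x (inj₁ (proj₂ (ends G e)))
  ∸+∸+≡2* : ∀ {a b c} → b ≤ a → c ≤ a → a ∸ b + (a ∸ c) + (b + c) ≡ 2 * a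
  ∸+∸+≡2* {a} {b} {c} b≤a c≤a = begin
    a ∸ b + (a ∸ c) + (b + c)   ≡⟨ interchange (a ∸ b) (a ∸ c) b c ⟩
    a ∸ b + b + (a ∸ c + c)     ≡⟨ cong₂ _+_ (m∸n+n≡m b≤a) (m∸n+n≡m c≤a) ⟩
    a + a                       ≡⟨ cong (a +_) (+-identityʳ a) ⟨
    2 * a                       ∎
    where
    interchange : ∀ w x y z → w + x + (y + z) ≡ w + y + (x + z)
    interchange = solve-∀

cost-identity : (G : Graph) (x : Seq G) → IsCSeq G x →
  cost G x + endpointSum G (pos G x ∘ inj₁) + 2 * vertexPosSum G x ≡ 2 * triangle (p G + q G)
cost-identity G x cseq = begin
  cost G x + endpointSum G (pos G x ∘ inj₁) + 2 * vertexPosSum G x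
    ≡⟨ cong (_+ 2 * vertexPosSum G x) (cost+endpointSum G x cseq) ⟩
  2 * edgePosSum G x + 2 * vertexPosSum G x
    ≡⟨ trans (*-distribˡ-+ 2 (vertexPosSum G x) _) (+-comm (2 * vertexPosSum G x) _) ⟨
  2 * (vertexPosSum G x + edgePosSum G x)
    ≡⟨ cong (2 *_) (vertexPosSum+edgePosSum G x) ⟩
  2 * triangle (p G + q G)
    ∎
  where open ≡-Reasoning

-- Some value of f is at least n, for otherwise f would inject Fin (1 + n) into Fin n;
-- removing it leaves n distinct values, which sum to at least T(n) by induction.
triangle≤sum : ∀ {n} (f : Fin n → ℕ) → Injective _≡_ _≡_ f → triangle n ≤ sum f
triangle≤sum {zero}  f f-injective = z≤n
triangle≤sum {suc n} f f-injective with any? (λ i → n ≤? f i)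
... | yes (i , n≤fi) = begin
  n + triangle n              ≤⟨ +-mono-≤ n≤fi (triangle≤sum (removeAt f i) rest-injective) ⟩
  f i + sum (removeAt f i)    ≡⟨ sum-remove {i = i} f ⟨
  sum f                       ∎
  where
  open ≤-Reasoning
  rest-injective : Injective _≡_ _≡_ (removeAt f i)
  rest-injective = punchIn-injective i _ _ ∘ f-injective
... | no ∄i[n≤fi] = contradiction (injective⇒≤ below-injective) (n≮n n)
  where
  below : Fin (suc n) → Fin n
  below i = fromℕ< (≰⇒> (∄i[n≤fi] ∘ (i ,_)))
  below-injective : Injective _≡_ _≡_ below
  below-injective {i} {j} below≡ = f-injective (begin
    f i              ≡⟨ toℕ-fromℕ< _ ⟨
    toℕ (below i)    ≡⟨ cong toℕ below≡ ⟩
    toℕ (below j)    ≡⟨ toℕ-fromℕ< _ ⟩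
    f j              ∎)
    where open ≡-Reasoning

triangle≤vertexPosSum : (G : Graph) (x : Seq G) → triangle (p G) ≤ vertexPosSum G x
triangle≤vertexPosSum G x = triangle≤sum (pos G x ∘ inj₁) (inj₁-injective ∘ pos-injective G x)

-- Vertex v sits at position v and edge e at position p G + e.
vertexFirst : (G : Graph) → Seq G
vertexFirst G = +↔⊎

vertexFirst-isCSeq : (G : Graph) → IsCSeq G (vertexFirst G)
vertexFirst-isCSeq G e = vertex<edge (proj₁ (ends G e)) , vertex<edge (proj₂ (ends G e))
  where
  vertex<edge : ∀ v → toℕ (v ↑ˡ q G) < toℕ (p G ↑ʳ e)
  vertex<edge v rewrite toℕ-↑ˡ v (q G) | toℕ-↑ʳ (p G) e = <-≤-trans (toℕ<n v) (m≤m+n (p G) (toℕ e))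

vertexPosSum-vertexFirst : (G : Graph) → vertexPosSum G (vertexFirst G) ≡ triangle (p G)
vertexPosSum-vertexFirst G = trans (sum-cong-≗ {p G} (λ v → toℕ-↑ˡ v (q G))) (sum-toℕ (p G))

IsMaxCost-unique : ∀ {G m n} → IsMaxCost G m → IsMaxCost G n → m ≡ n
IsMaxCost-unique ((x , x-cseq , refl) , m-max) ((y , y-cseq , refl) , n-max) =
  ≤-antisym (n-max x x-cseq) (m-max y y-cseq)

isMaxCost-byPotential : ∀ {G} (Φ : Seq G → ℕ) {c : ℕ} {x₀ : Seq G} →
  (∀ x → IsCSeq G x → cost G x + Φ x ≡ c) → IsCSeq G x₀ → (∀ x → Φ x₀ ≤ Φ x) →
  IsMaxCost G (cost G x₀)
isMaxCost-byPotential {G} Φ {c} {x₀} cost+Φ≡c x₀-cseq x₀-minimal =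
  (x₀ , x₀-cseq , refl) , λ x x-cseq → +-cancelʳ-≤ (Φ x₀) _ _ (begin
    cost G x + Φ x₀     ≤⟨ +-monoʳ-≤ (cost G x) (x₀-minimal x) ⟩
    cost G x + Φ x      ≡⟨ cost+Φ≡c x x-cseq ⟩
    c                   ≡⟨ cost+Φ≡c x₀ x₀-cseq ⟨
    cost G x₀ + Φ x₀    ∎)
  where open ≤-Reasoning

module _ (G : Graph) {r : ℕ} (loopless : Loopless G) (regular : Regular r G) where

  cost+potential-regular : ∀ x → IsCSeq G x →
    cost G x + (2 + r) * vertexPosSum G x ≡ 2 * triangle (p G + q G)
  cost+potential-regular x cseq = begin
    cost G x + (2 + r) * vertexPosSum G x
      ≡⟨ regroup (cost G x) r (vertexPosSum G x) ⟩
    cost G x + r * vertexPosSum G x + 2 * vertexPosSum G x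
      ≡⟨ cong (λ s → cost G x + s + 2 * vertexPosSum G x) (endpointSum-regular G loopless regular _) ⟨
    cost G x + endpointSum G (pos G x ∘ inj₁) + 2 * vertexPosSum G x
      ≡⟨ cost-identity G x cseq ⟩
    2 * triangle (p G + q G)
      ∎
    where
    open ≡-Reasoning
    regroup : ∀ c r v → c + (2 + r) * v ≡ c + r * v + 2 * v
    regroup = solve-∀

  vertexFirst-isMaxCost : IsMaxCost G (cost G (vertexFirst G))
  vertexFirst-isMaxCost =
    isMaxCost-byPotential (λ x → (2 + r) * vertexPosSum G x) {x₀ = vertexFirst G}
      cost+potential-regular (vertexFirst-isCSeq G)
      (λ x → *-monoʳ-≤ (2 + r) (subst (_≤ vertexPosSum G x) (sym (vertexPosSum-vertexFirst G))
                                      (triangle≤vertexPosSum G x)))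

  maxCost-regular : ∀ {m} → IsMaxCost G m →
    m + (2 + r) * triangle (p G) ≡ 2 * triangle (p G + q G)
  maxCost-regular {m} max = begin
    m + (2 + r) * triangle (p G)
      ≡⟨ cong₂ (λ c t → c + (2 + r) * t) (IsMaxCost-unique max vertexFirst-isMaxCost)
                                         (sym (vertexPosSum-vertexFirst G)) ⟩
    cost G x₀ + (2 + r) * vertexPosSum G x₀
      ≡⟨ cost+potential-regular x₀ (vertexFirst-isCSeq G) ⟩
    2 * triangle (p G + q G)
      ∎
    where
    open ≡-Reasoning
    x₀ = vertexFirst G

module _ (G₁ G₂ : Graph) where

  vertexPosSumˡ vertexPosSumʳ : Seq (G₁ ⊔ G₂) → ℕ
  vertexPosSumˡ x = sum (λ v → pos (G₁ ⊔ G₂) x (inj₁ (v ↑ˡ p G₂)))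
  vertexPosSumʳ x = sum (λ v → pos (G₁ ⊔ G₂) x (inj₁ (p G₁ ↑ʳ v)))

  vertexPosSum-⊔ : ∀ x → vertexPosSum (G₁ ⊔ G₂) x ≡ vertexPosSumˡ x + vertexPosSumʳ x
  vertexPosSum-⊔ x = sum-split (p G₁) (pos (G₁ ⊔ G₂) x ∘ inj₁)

  endpointSum-⊔ : (f : Fin (p G₁ + p G₂) → ℕ) →
    endpointSum (G₁ ⊔ G₂) f ≡ endpointSum G₁ (f ∘ (_↑ˡ p G₂)) + endpointSum G₂ (f ∘ (p G₁ ↑ʳ_))
  endpointSum-⊔ f = trans (sum-split (q G₁) _)
    (cong₂ _+_ (sum-cong-≗ {q G₁} (λ e → cong endpointValue (unionEnds-↑ˡ e)))
               (sum-cong-≗ {q G₂} (λ e → cong endpointValue (unionEnds-↑ʳ e))))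
    where
    endpointValue : Fin (p G₁ + p G₂) × Fin (p G₁ + p G₂) → ℕ
    endpointValue (u , w) = f u + f w
    unionEnds-↑ˡ : ∀ e → unionEnds G₁ G₂ (e ↑ˡ q G₂) ≡ inl (p G₂) (ends G₁ e)
    unionEnds-↑ˡ e rewrite splitAt-↑ˡ (q G₁) e (q G₂) = refl
    unionEnds-↑ʳ : ∀ e → unionEnds G₁ G₂ (q G₁ ↑ʳ e) ≡ inr (p G₁) (ends G₂ e)
    unionEnds-↑ʳ e rewrite splitAt-↑ʳ (q G₁) (q G₂) e = refl

-- With w₁ = w₂ + d the weighted sum is d a + w₂ (a + b), monotone in a and in a + b.
weightedSum-mono-≤ : ∀ {w₁ w₂ a₀ b₀ a b} → w₂ ≤ w₁ → a₀ ≤ a → a₀ + b₀ ≤ a + b →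
  w₁ * a₀ + w₂ * b₀ ≤ w₁ * a + w₂ * b
weightedSum-mono-≤ {w₁} {w₂} {a₀} {b₀} {a} {b} w₂≤w₁ a₀≤a a₀+b₀≤a+b
  with d , refl ← m≤n⇒∃[o]m+o≡n w₂≤w₁ = begin
    (w₂ + d) * a₀ + w₂ * b₀   ≡⟨ regroup w₂ d a₀ b₀ ⟩
    d * a₀ + w₂ * (a₀ + b₀)   ≤⟨ +-mono-≤ (*-monoʳ-≤ d a₀≤a) (*-monoʳ-≤ w₂ a₀+b₀≤a+b) ⟩
    d * a + w₂ * (a + b)      ≡⟨ regroup w₂ d a b ⟨
    (w₂ + d) * a + w₂ * b     ∎
  where
  open ≤-Reasoning
  regroup : ∀ w d a b → (w + d) * a + w * b ≡ d * a + w * (a + b)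
  regroup = solve-∀

maxCost-⊔-arithmetic : ∀ c c₁ c₂ p₁ q₁ p₂ q₂ r₁ r₂ t₁ t₂ T₁ T₂ →
  c₁ + (2 + r₁) * t₁ ≡ 2 * T₁ →
  c₂ + (2 + r₂) * t₂ ≡ 2 * T₂ →
  c + ((2 + r₁) * t₁ + (2 + r₂) * (p₂ * p₁ + t₂)) ≡ 2 * (T₁ + (p₁ + q₁) * (p₂ + q₂) + T₂) →
  r₂ * p₂ ≡ 2 * q₂ →
  c ≡ c₁ + c₂ + 2 * q₁ * (p₂ + q₂)
maxCost-⊔-arithmetic c c₁ c₂ p₁ q₁ p₂ q₂ r₁ r₂ t₁ t₂ T₁ T₂ max₁ max₂ max-⊔ handshake₂ =
  +-cancelʳ-≡ X c (c₁ + c₂ + 2 * q₁ * (p₂ + q₂)) (begin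
  c + X
    ≡⟨ max-⊔ ⟩
  2 * (T₁ + (p₁ + q₁) * (p₂ + q₂) + T₂)
    ≡⟨ solve (T₁ ∷ T₂ ∷ p₁ ∷ q₁ ∷ p₂ ∷ q₂ ∷ []) ⟩
  2 * T₁ + 2 * T₂ + 2 * (p₁ + q₁) * (p₂ + q₂)
    ≡⟨ cong₂ (λ a b → a + b + 2 * (p₁ + q₁) * (p₂ + q₂)) max₁ max₂ ⟨
  c₁ + (2 + r₁) * t₁ + (c₂ + (2 + r₂) * t₂) + 2 * (p₁ + q₁) * (p₂ + q₂)
    ≡⟨ solve (c₁ ∷ c₂ ∷ r₁ ∷ r₂ ∷ t₁ ∷ t₂ ∷ p₁ ∷ q₁ ∷ p₂ ∷ q₂ ∷ []) ⟩
  c₁ + c₂ + 2 * q₁ * (p₂ + q₂) + ((2 + r₁) * t₁ + (2 + r₂) * t₂ + 2 * p₂ * p₁) + 2 * q₂ * p₁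
    ≡⟨ cong₂ _+_ refl (cong (_* p₁) handshake₂) ⟨
  c₁ + c₂ + 2 * q₁ * (p₂ + q₂) + ((2 + r₁) * t₁ + (2 + r₂) * t₂ + 2 * p₂ * p₁) + r₂ * p₂ * p₁
    ≡⟨ solve (c₁ ∷ c₂ ∷ r₁ ∷ r₂ ∷ t₁ ∷ t₂ ∷ p₁ ∷ q₁ ∷ p₂ ∷ q₂ ∷ []) ⟩
  c₁ + c₂ + 2 * q₁ * (p₂ + q₂) + ((2 + r₁) * t₁ + (2 + r₂) * (p₂ * p₁ + t₂))
    ∎)
  where
  open ≡-Reasoning
  X = (2 + r₁) * t₁ + (2 + r₂) * (p₂ * p₁ + t₂)

module _ (G₁ G₂ : Graph) {r₁ r₂ : ℕ} (loopless₁ : Loopless G₁) (loopless₂ : Loopless G₂)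
         (regular₁ : Regular r₁ G₁) (regular₂ : Regular r₂ G₂) where

  private
    G  = G₁ ⊔ G₂
    x₀ = vertexFirst G
    Φ : Seq G → ℕ
    Φ x = (2 + r₁) * vertexPosSumˡ G₁ G₂ x + (2 + r₂) * vertexPosSumʳ G₁ G₂ x

  cost+potential-⊔ : ∀ x → IsCSeq G x → cost G x + Φ x ≡ 2 * triangle (p G + q G)
  cost+potential-⊔ x cseq = begin
    cost G x + Φ x
      ≡⟨ regroup (cost G x) r₁ r₂ A B ⟩
    cost G x + (r₁ * A + r₂ * B) + 2 * (A + B)
      ≡⟨ cong₂ (λ s v → cost G x + s + 2 * v) (sym endpointSum≡) (sym (vertexPosSum-⊔ G₁ G₂ x)) ⟩
    cost G x + endpointSum G (pos G x ∘ inj₁) + 2 * vertexPosSum G x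
      ≡⟨ cost-identity G x cseq ⟩
    2 * triangle (p G + q G)
      ∎
    where
    open ≡-Reasoning
    A = vertexPosSumˡ G₁ G₂ x
    B = vertexPosSumʳ G₁ G₂ x
    regroup : ∀ c r₁ r₂ a b → c + ((2 + r₁) * a + (2 + r₂) * b) ≡ c + (r₁ * a + r₂ * b) + 2 * (a + b)
    regroup = solve-∀
    endpointSum≡ : endpointSum G (pos G x ∘ inj₁) ≡ r₁ * A + r₂ * B
    endpointSum≡ = trans (endpointSum-⊔ G₁ G₂ (pos G x ∘ inj₁))
      (cong₂ _+_ (endpointSum-regular G₁ loopless₁ regular₁ _) (endpointSum-regular G₂ loopless₂ regular₂ _))

  vertexPosSumˡ-vertexFirst : vertexPosSumˡ G₁ G₂ x₀ ≡ triangle (p G₁)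
  vertexPosSumˡ-vertexFirst = trans
    (sum-cong-≗ {p G₁} {pos G x₀ ∘ inj₁ ∘ (_↑ˡ p G₂)}
      (λ v → trans (toℕ-↑ˡ (v ↑ˡ p G₂) (q G)) (toℕ-↑ˡ v (p G₂))))
    (sum-toℕ (p G₁))

  vertexPosSumʳ-vertexFirst : vertexPosSumʳ G₁ G₂ x₀ ≡ p G₂ * p G₁ + triangle (p G₂)
  vertexPosSumʳ-vertexFirst = begin
    vertexPosSumʳ G₁ G₂ x₀
      ≡⟨ sum-cong-≗ {p G₂} {pos G x₀ ∘ inj₁ ∘ (p G₁ ↑ʳ_)}
           (λ v → trans (toℕ-↑ˡ (p G₁ ↑ʳ v) (q G)) (toℕ-↑ʳ (p G₁) v)) ⟩
    sum {p G₂} (λ v → p G₁ + toℕ v)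
      ≡⟨ ∑-distrib-+ {p G₂} (λ _ → p G₁) toℕ ⟩
    sum {p G₂} (λ _ → p G₁) + sum {p G₂} toℕ
      ≡⟨ cong₂ _+_ (sum-const (p G₂) (p G₁)) (sum-toℕ (p G₂)) ⟩
    p G₂ * p G₁ + triangle (p G₂)
      ∎
    where open ≡-Reasoning

  vertexFirst-isMaxCost-⊔ : r₂ ≤ r₁ → IsMaxCost G (cost G x₀)
  vertexFirst-isMaxCost-⊔ r₂≤r₁ =
    isMaxCost-byPotential Φ {x₀ = x₀} cost+potential-⊔ (vertexFirst-isCSeq G) Φ-minimal
    where
    Φ-minimal : ∀ x → Φ x₀ ≤ Φ x
    Φ-minimal x = weightedSum-mono-≤ (s≤s (s≤s r₂≤r₁)) ˡ-minimal ˡʳ-minimal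
      where
      A = vertexPosSumˡ G₁ G₂
      B = vertexPosSumʳ G₁ G₂
      ˡ-minimal : A x₀ ≤ A x
      ˡ-minimal = subst (_≤ A x) (sym vertexPosSumˡ-vertexFirst)
        (triangle≤sum _ (↑ˡ-injective (p G₂) _ _ ∘ inj₁-injective ∘ pos-injective G x))
      ˡʳ-minimal : A x₀ + B x₀ ≤ A x + B x
      ˡʳ-minimal = subst₂ _≤_
        (trans (sym (vertexPosSum-vertexFirst G)) (vertexPosSum-⊔ G₁ G₂ x₀)) (vertexPosSum-⊔ G₁ G₂ x)
        (triangle≤vertexPosSum G x)

  cost+potential-vertexFirst-⊔ :
    cost G x₀ + ((2 + r₁) * triangle (p G₁) + (2 + r₂) * (p G₂ * p G₁ + triangle (p G₂)))
      ≡ 2 * (triangle (p G₁ + q G₁) + (p G₁ + q G₁) * (p G₂ + q G₂) + triangle (p G₂ + q G₂))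
  cost+potential-vertexFirst-⊔ = begin
    cost G x₀ + ((2 + r₁) * triangle (p G₁) + (2 + r₂) * (p G₂ * p G₁ + triangle (p G₂)))
      ≡⟨ cong₂ (λ a b → cost G x₀ + ((2 + r₁) * a + (2 + r₂) * b))
               (sym vertexPosSumˡ-vertexFirst) (sym vertexPosSumʳ-vertexFirst) ⟩
    cost G x₀ + Φ x₀
      ≡⟨ cost+potential-⊔ x₀ (vertexFirst-isCSeq G) ⟩
    2 * triangle ((p G₁ + p G₂) + (q G₁ + q G₂))
      ≡⟨ cong (λ n → 2 * triangle n) (interchange (p G₁) (p G₂) (q G₁) (q G₂)) ⟩
    2 * triangle ((p G₁ + q G₁) + (p G₂ + q G₂))
      ≡⟨ cong (2 *_) (triangle-+ (p G₁ + q G₁) (p G₂ + q G₂)) ⟩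
    2 * (triangle (p G₁ + q G₁) + (p G₁ + q G₁) * (p G₂ + q G₂) + triangle (p G₂ + q G₂))
      ∎
    where
    open ≡-Reasoning
    interchange : ∀ a b c d → a + b + (c + d) ≡ a + c + (b + d)
    interchange = solve-∀

  cost-vertexFirst-⊔ : ∀ {m₁ m₂} → IsMaxCost G₁ m₁ → IsMaxCost G₂ m₂ →
    cost G x₀ ≡ m₁ + m₂ + 2 * q G₁ * (p G₂ + q G₂)
  cost-vertexFirst-⊔ {m₁} {m₂} max₁ max₂ =
    maxCost-⊔-arithmetic (cost G x₀) m₁ m₂ (p G₁) (q G₁) (p G₂) (q G₂) r₁ r₂
      (triangle (p G₁)) (triangle (p G₂)) (triangle (p G₁ + q G₁)) (triangle (p G₂ + q G₂))
      (maxCost-regular G₁ loopless₁ regular₁ max₁) (maxCost-regular G₂ loopless₂ regular₂ max₂)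
      cost+potential-vertexFirst-⊔ (regular-handshake G₂ loopless₂ regular₂)

theorem5 : (G₁ G₂ : Graph) (r₁ r₂ : ℕ) →
    IsSimple G₁ → IsSimple G₂ →
    Regular r₁ G₁ → Regular r₂ G₂ → r₁ > r₂ →
    (m₁ m₂ : ℕ) → IsMaxCost G₁ m₁ → IsMaxCost G₂ m₂ →
    IsMaxCost (G₁ ⊔ G₂) (m₁ + m₂ + 2 * q G₁ * (p G₂ + q G₂))
theorem5 G₁ G₂ r₁ r₂ simple₁ simple₂ regular₁ regular₂ r₂<r₁ m₁ m₂ max₁ max₂ =
  subst (IsMaxCost (G₁ ⊔ G₂)) (cost-vertexFirst-⊔ G₁ G₂ loopless₁ loopless₂ regular₁ regular₂ max₁ max₂)
    (vertexFirst-isMaxCost-⊔ G₁ G₂ loopless₁ loopless₂ regular₁ regular₂ (<⇒≤ r₂<r₁))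
  where
  loopless₁ = IsSimple.loopless simple₁
  loopless₂ = IsSimple.loopless simple₂
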